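{- Let $F_n$ be the friendship graph with $n \ge 2$. Then $\gamma(M(F_n)) = n+1$.
   Context: The friendship graph $F_n$ of order $2n+1$ is obtained by joining $n$ copies of the triangle $C_3$ at a common vertex; i.e. it has vertices $v_0,\dots,v_{2n}$ and edges $v_0v_i$ for $1\le i\le 2n$ together with $v_{2k-1}v_{2k}$ for $1\le k\le n$. For a finite simple graph $H$, the middle graph $M(H)$ is the graph with vertex set $V(H)\cup E(H)$ in which two elements $x,y$ are adjacent if and only if either (1) $x,y\in E(H)$ and the edges $x,y$ share a common endpoint in $H$, or (2) $x\in V(H)$, $y\in E(H)$ and $x$ is an endpoint of $y$ (or vice versa). A dominating set of a graph $H$ is a set $S\subseteq V(H)$ such that every vertex of $H$ is in $S$ or adjacent to a vertex of $S$; the domination number $\gamma(H)$ is the minimum cardinality of a dominating set of $H$. -}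

module Defs where

open import Data.Nat using (ℕ; suc; _*_; _≤_)
open import Data.Fin using (Fin; zero; suc; combine)
open import Data.Product using (Σ; _×_; _,_; proj₁; proj₂)
open import Data.Sum using (_⊎_; inj₁; inj₂)
open import Data.Empty using (⊥)
open import Data.List using (List; length)
open import Data.List.Membership.Propositional using (_∈_)
open import Data.List.Relation.Unary.Unique.Propositional using (Unique)
open import Relation.Binary.PropositionalEquality using (_≡_; _≢_)

record Graph : Set₁ where
  field
    V    : Set
    E    : Set
    ends : E → V × V

open Graph public

Incident : (H : Graph) → V H → E H → Set
Incident H x e = (x ≡ proj₁ (ends H e)) ⊎ (x ≡ proj₂ (ends H e))

MVertex : Graph → Set
MVertex H = V H ⊎ E H

MAdj : (H : Graph) → MVertex H → MVertex H → Set
MAdj H (inj₁ x) (inj₁ y) = ⊥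
MAdj H (inj₁ x) (inj₂ e) = Incident H x e
MAdj H (inj₂ e) (inj₁ x) = Incident H x e
MAdj H (inj₂ e) (inj₂ f) = (e ≢ f) × Σ (V H) (λ x → Incident H x e × Incident H x f)

-- Domination in a graph with vertex type A and adjacency Adj;
-- finite vertex sets are duplicate-free lists, cardinality = length.
Dominating : {A : Set} → (A → A → Set) → List A → Set
Dominating {A} Adj S = (u : A) → (u ∈ S) ⊎ Σ A (λ w → (w ∈ S) × Adj w u)

DominationNumberIs : {A : Set} → (A → A → Set) → ℕ → Set
DominationNumberIs {A} Adj k =
  Σ (List A) (λ S → Unique S × Dominating Adj S × length S ≡ k)
  × ((S : List A) → Unique S → Dominating Adj S → k ≤ length S)

-- Friendship graph F_n: vertices v_0 = zero, v_i = suc (i-1) for 1 ≤ i ≤ 2n.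
-- Edges: spokes v_0 v_i (1 ≤ i ≤ 2n), and triangle edges v_{2k+1} v_{2k+2}
-- for k = 0..n-1 (combine k j = 2k + j).
FEdge : ℕ → Set
FEdge n = Fin (n * 2) ⊎ Fin n

friendshipEnds : (n : ℕ) → FEdge n → Fin (suc (n * 2)) × Fin (suc (n * 2))
friendshipEnds n (inj₁ i) = zero , suc i
friendshipEnds n (inj₂ k) = suc (combine k zero) , suc (combine k (suc zero))

Friendship : ℕ → Graph
Friendship n = record { V = Fin (suc (n * 2)) ; E = FEdge n ; ends = friendshipEnds n }

module Submission where

-- Write v₀ for the hub of F_n, rim k q (k < n, q < 2) for the two outer
-- vertices of the k-th triangle, spokes for the edges v₀ v_i and triangle
-- edges for the outer edges v_{2k+1} v_{2k+2}.
--
-- Upper bound: {v₀} ∪ {triangle edges} is dominating in M(F_n): v₀ covers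
-- the spokes and the k-th triangle edge covers both rim vertices of triangle k.
--
-- Lower bound: every element dominating a rim vertex of triangle k belongs
-- to triangle k (a rim vertex, a spoke to it, or the triangle edge), so
-- choosing one dominator for every rim vertex of a fixed side q gives n
-- distinct members of S.  The dominator of v₀ is v₀ itself or a spoke to a
-- rim vertex on side p; in either case it dominates no rim vertex on some
-- side q (any side for v₀, the other side for the spoke), hence it is an
-- (n+1)-st distinct member of S.

open import Defs
open import Data.Nat using (ℕ; suc; _*_; _≤_)
open import Data.Fin using (Fin; zero; suc; combine; remQuot)
open import Data.Fin.Properties
  using (injective⇒≤; remQuot-combine; combine-remQuot; combine-injectiveˡ; combine-injectiveʳ; suc-injective)
open import Data.Maybe using (Maybe; just; nothing)
open import Data.Maybe.Properties using (just-injective)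
open import Data.Product using (Σ; _×_; _,_; proj₁; proj₂)
open import Data.Sum using (_⊎_; inj₁; inj₂)
open import Data.Empty using (⊥-elim)
open import Data.List using (List; length; _∷_; tabulate; lookup)
open import Data.List.Membership.Propositional using (_∈_)
open import Data.List.Membership.Propositional.Properties using (∈-tabulate⁺)
open import Data.List.Relation.Unary.Any using (here; there; index)
open import Data.List.Relation.Unary.Any.Properties using (lookup-index)
open import Data.List.Relation.Unary.Unique.Propositional using (Unique)
open import Data.List.Relation.Unary.Unique.Propositional.Properties as Unique using ()
open import Data.List.Relation.Unary.All.Properties as All using ()
open import Data.List.Relation.Unary.AllPairs using (_∷_)
open import Data.List.Properties using (length-tabulate)
open import Function.Definitions using (Injective)
open import Relation.Binary.PropositionalEquality
open import Relation.Nullary using (¬_)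

module _ {A : Set} where

  -- A family of m pairwise distinct members of a list forces the list to
  -- have at least m entries: their positions form an injection into it.
  distinctMembers⇒≤length : ∀ {m} (S : List A) (g : Fin m → A) →
    (∀ i → g i ∈ S) → Injective _≡_ _≡_ g → m ≤ length S
  distinctMembers⇒≤length S g g∈S g-inj = injective⇒≤ position-injective
    where
    position-injective : Injective _≡_ _≡_ (λ i → index (g∈S i))
    position-injective {i} {j} same = g-inj (begin
      g i                        ≡⟨ lookup-index (g∈S i) ⟩
      lookup S (index (g∈S i))   ≡⟨ cong (lookup S) same ⟩
      lookup S (index (g∈S j))   ≡⟨ lookup-index (g∈S j) ⟨
      g j                        ∎)
      where open ≡-Reasoning

  extend : ∀ {m} → A → (Fin m → A) → Fin (suc m) → A
  extend e g zero    = e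
  extend e g (suc i) = g i

  extend-injective : ∀ {m} (e : A) (g : Fin m → A) → (∀ i → g i ≢ e) →
    Injective _≡_ _≡_ g → Injective _≡_ _≡_ (extend e g)
  extend-injective e g fresh g-inj {zero}  {zero}  _  = refl
  extend-injective e g fresh g-inj {zero}  {suc j} eq = ⊥-elim (fresh j (sym eq))
  extend-injective e g fresh g-inj {suc i} {zero}  eq = ⊥-elim (fresh i eq)
  extend-injective e g fresh g-inj {suc i} {suc j} eq = cong suc (g-inj eq)

module _ {A : Set} (Adj : A → A → Set) where

  Dominates : A → A → Set
  Dominates w u = (w ≡ u) ⊎ Adj w u

  dominatorIn : ∀ {S} → Dominating Adj S → (u : A) → Σ A (λ w → w ∈ S × Dominates w u)
  dominatorIn dom u with dom u
  ... | inj₁ u∈S             = u , u∈S , inj₁ refl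
  ... | inj₂ (w , w∈S , adj) = w , w∈S , inj₂ adj

module _ (n : ℕ) where

  M : Set
  M = MVertex (Friendship n)

  Adj : M → M → Set
  Adj = MAdj (Friendship n)

  hub : M
  hub = inj₁ zero

  rim : Fin n → Fin 2 → M
  rim k q = inj₁ (suc (combine k q))

  spoke : Fin (n * 2) → M
  spoke i = inj₂ (inj₁ i)

  triangleEdge : Fin n → M
  triangleEdge k = inj₂ (inj₂ k)

  rimPosition : (i : Fin (n * 2)) → Σ (Fin n) (λ k → Σ (Fin 2) (λ q → i ≡ combine k q))
  rimPosition i = proj₁ (remQuot {n} 2 i) , proj₂ (remQuot {n} 2 i) , sym (combine-remQuot {n} 2 i)

  hubAndTriangles : List M
  hubAndTriangles = hub ∷ tabulate triangleEdge

  hubAndTriangles-unique : Unique hubAndTriangles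
  hubAndTriangles-unique = All.tabulate⁺ (λ _ ()) ∷ Unique.tabulate⁺ (λ { refl → refl })

  triangleEdge-dominates-rim : ∀ k q → Adj (triangleEdge k) (rim k q)
  triangleEdge-dominates-rim k zero       = inj₁ refl
  triangleEdge-dominates-rim k (suc zero) = inj₂ refl

  hubAndTriangles-dominating : Dominating Adj hubAndTriangles
  hubAndTriangles-dominating (inj₁ zero) = inj₁ (here refl)
  hubAndTriangles-dominating (inj₁ (suc i)) with rimPosition i
  ... | k , q , refl = inj₂ (triangleEdge k , there (∈-tabulate⁺ k) , triangleEdge-dominates-rim k q)
  hubAndTriangles-dominating (inj₂ (inj₁ i)) = inj₂ (hub , here refl , inj₁ refl)
  hubAndTriangles-dominating (inj₂ (inj₂ k)) = inj₁ (there (∈-tabulate⁺ k))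

  hubAndTriangles-length : length hubAndTriangles ≡ suc n
  hubAndTriangles-length = cong suc (length-tabulate triangleEdge)

  triangleOf : M → Maybe (Fin n)
  triangleOf (inj₁ zero)     = nothing
  triangleOf (inj₁ (suc i))  = just (proj₁ (remQuot {n} 2 i))
  triangleOf (inj₂ (inj₁ i)) = just (proj₁ (remQuot {n} 2 i))
  triangleOf (inj₂ (inj₂ k)) = just k

  rimDominator-triangle : ∀ k q w → Dominates Adj w (rim k q) → triangleOf w ≡ just k
  rimDominator-triangle k q w (inj₁ refl) = cong (λ r → just (proj₁ r)) (remQuot-combine k q)
  rimDominator-triangle k q (inj₂ (inj₁ i)) (inj₂ (inj₂ eq)) rewrite sym (suc-injective eq) =
    cong (λ r → just (proj₁ r)) (remQuot-combine k q)
  rimDominator-triangle k q (inj₂ (inj₂ l)) (inj₂ (inj₁ eq)) =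
    cong just (combine-injectiveˡ l zero k q (sym (suc-injective eq)))
  rimDominator-triangle k q (inj₂ (inj₂ l)) (inj₂ (inj₂ eq)) =
    cong just (combine-injectiveˡ l (suc zero) k q (sym (suc-injective eq)))

  spoke-dominates-rim⇒sameSide : ∀ j p k q → Dominates Adj (spoke (combine j p)) (rim k q) → q ≡ p
  spoke-dominates-rim⇒sameSide j p k q (inj₂ (inj₂ eq)) = combine-injectiveʳ k q j p (suc-injective eq)

  otherSide : Fin 2 → Fin 2
  otherSide zero       = suc zero
  otherSide (suc zero) = zero

  otherSide≢ : ∀ p → otherSide p ≢ p
  otherSide≢ zero ()
  otherSide≢ (suc zero) ()

  hubDominator-missesSide : ∀ w → Dominates Adj w hub →
    Σ (Fin 2) (λ q → ∀ k → ¬ Dominates Adj w (rim k q))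
  hubDominator-missesSide w (inj₁ refl) = zero , λ { k (inj₁ ()) ; k (inj₂ ()) }
  hubDominator-missesSide (inj₂ (inj₁ i)) (inj₂ _) with rimPosition i
  ... | j , p , refl = otherSide p , λ k dom → otherSide≢ p (spoke-dominates-rim⇒sameSide j p k (otherSide p) dom)
  hubDominator-missesSide (inj₂ (inj₂ k)) (inj₂ (inj₁ ()))
  hubDominator-missesSide (inj₂ (inj₂ k)) (inj₂ (inj₂ ()))

  -- The lower bound: the hub's dominator and the dominators of the rims on
  -- a side it misses are n + 1 distinct members of S.
  lowerBound : (S : List M) → Dominating Adj S → suc n ≤ length S
  lowerBound S dom =
    distinctMembers⇒≤length S (extend e rimDominator) members
      (extend-injective e rimDominator fresh rimDominator-injective)
    where
    e : M
    e = proj₁ (dominatorIn Adj dom hub)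

    e∈S : e ∈ S
    e∈S = proj₁ (proj₂ (dominatorIn Adj dom hub))

    side : Σ (Fin 2) (λ q → ∀ k → ¬ Dominates Adj e (rim k q))
    side = hubDominator-missesSide e (proj₂ (proj₂ (dominatorIn Adj dom hub)))

    q : Fin 2
    q = proj₁ side

    rimDominator : Fin n → M
    rimDominator k = proj₁ (dominatorIn Adj dom (rim k q))

    rimDominator-dominates : ∀ k → Dominates Adj (rimDominator k) (rim k q)
    rimDominator-dominates k = proj₂ (proj₂ (dominatorIn Adj dom (rim k q)))

    members : ∀ i → extend e rimDominator i ∈ S
    members zero    = e∈S
    members (suc k) = proj₁ (proj₂ (dominatorIn Adj dom (rim k q)))

    rimDominator-injective : Injective _≡_ _≡_ rimDominator
    rimDominator-injective {k} {l} eq = just-injective (begin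
      just k                        ≡⟨ rimDominator-triangle k q _ (rimDominator-dominates k) ⟨
      triangleOf (rimDominator k)   ≡⟨ cong triangleOf eq ⟩
      triangleOf (rimDominator l)   ≡⟨ rimDominator-triangle l q _ (rimDominator-dominates l) ⟩
      just l                        ∎)
      where open ≡-Reasoning

    fresh : ∀ k → rimDominator k ≢ e
    fresh k eq = proj₂ side k (subst (λ w → Dominates Adj w (rim k q)) eq (rimDominator-dominates k))

proposition3p15 : (n : ℕ) → 2 ≤ n → DominationNumberIs (MAdj (Friendship n)) (suc n)
proposition3p15 n _ =
  (hubAndTriangles n , hubAndTriangles-unique n , hubAndTriangles-dominating n , hubAndTriangles-length n) ,
  λ S _ dom → lowerBound n S dom
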